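{- Let $k\ge 0$ and $n\ge 3k+1$ be integers, and let $w$ be a composition of $n$ having exactly $k$ entries equal to $1$. Then $w$ is uniquely determined by its set of $k$-deletions: if $w'$ is any composition whose set of $k$-deletions equals that of $w$, then $w'=w$.
   Context: A composition is a finite word $w=w(1)w(2)\cdots w(m)$ whose letters are positive integers; it is a composition of $n$ if $w(1)+\cdots+w(m)=n$. A $1$-deletion of $w$ is a composition obtained from $w$ either by lowering an entry that is $\ge 2$ by $1$, or by removing an entry equal to $1$. For $k\ge 0$, the $k$-deletions of $w$ are defined recursively: the only $0$-deletion of $w$ is $w$ itself, and a $k$-deletion is a $1$-deletion of a $(k-1)$-deletion. -}

module Defs where

open import Data.Nat using (ℕ; zero; suc; _+_; _≤_; _<_)
open import Data.List using (List; []; _∷_; filter; length)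
open import Data.Nat.ListAction using (sum)
open import Data.Product using (_×_)
open import Data.List.Relation.Unary.All using (All)
open import Data.Nat.Properties using (_≟_)
open import Relation.Binary.PropositionalEquality using (_≡_)

IsComposition : List ℕ → Set
IsComposition w = All (λ a → 1 ≤ a) w

IsCompositionOf : ℕ → List ℕ → Set
IsCompositionOf n w = IsComposition w × sum w ≡ n

ones : List ℕ → ℕ
ones w = length (filter (_≟ 1) w)

data OneDel : List ℕ → List ℕ → Set where
  lower  : ∀ {a w} → 1 ≤ a → OneDel (suc a ∷ w) (a ∷ w)
  remove : ∀ {w} → OneDel (1 ∷ w) w
  there  : ∀ {a w u} → OneDel w u → OneDel (a ∷ w) (a ∷ u)

data KDel : ℕ → List ℕ → List ℕ → Set where
  zero-del : ∀ {w} → KDel zero w w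
  step-del : ∀ {k w v u} → KDel k w v → OneDel v u → KDel (suc k) w u

{-# OPTIONS --safe #-}
-- Let u be w with its k ones removed. It is a k-deletion of w, hence of w′: so w′ has the same
-- sum as w and at most |w| entries, and since u is reached from w′ in k steps losing k entries,
-- every step removes a one, so w′ with its ones removed is u as well. The bound n ≥ 3k + 1 leaves
-- room to lower w by k without removing anything while keeping any one chosen entry ≥ 2; such a
-- deletion is a length-preserving deletion of w′, hence bounded by w′ entrywise. So every entry ≥ 2
-- of w sits opposite an entry ≥ 2 of w′ and, symmetrically, vice versa; with the common u, w′ = w.
module Submission where

open import Defs
open import Data.Nat using (ℕ; zero; suc; _+_; _*_; _≤_; _<_; z≤n; s≤s; _≤?_)
open import Data.Nat.Properties
open import Data.Nat.ListAction using (sum)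
open import Data.Nat.Tactic.RingSolver using (solve-∀)
open import Data.Bool using (true; false)
open import Data.List using (List; []; _∷_; length; filter; map)
open import Data.List.Properties using (∷-injective; filter-idem)
open import Data.List.Relation.Unary.All using ([]; _∷_)
open import Data.List.Relation.Binary.Pointwise using (Pointwise; []; _∷_; head; tail; Pointwise-length)
import Data.List.Relation.Binary.Pointwise as Pointwise
open import Data.Product using (_×_; _,_; ∃-syntax)
open import Data.Sum using (inj₁; inj₂)
open import Data.Empty using (⊥-elim)
open import Function.Bundles using (_⇔_; Equivalence)
open import Relation.Nullary using (¬?; does; yes; no)
open import Relation.Binary.PropositionalEquality using (_≡_; refl; sym; trans; cong; subst₂)

bigs : List ℕ → List ℕ
bigs = filter (λ a → ¬? (a ≟ 1))

infix 4 _≤*_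

_≤*_ : List ℕ → List ℕ → Set
_≤*_ = Pointwise _≤_

units : List ℕ → List ℕ
units = map (λ _ → 1)

oneDel-sum : ∀ {v u} → OneDel v u → sum v ≡ suc (sum u)
oneDel-sum (lower _)         = refl
oneDel-sum remove            = refl
oneDel-sum {a ∷ _} (there d) = trans (cong (a +_) (oneDel-sum d)) (+-suc a _)

oneDel-length-≤ : ∀ {v u} → OneDel v u → length u ≤ length v
oneDel-length-≤ (lower _) = ≤-refl
oneDel-length-≤ remove    = n≤1+n _
oneDel-length-≤ (there d) = s≤s (oneDel-length-≤ d)

oneDel-length-≤-suc : ∀ {v u} → OneDel v u → length v ≤ suc (length u)
oneDel-length-≤-suc (lower _) = n≤1+n _
oneDel-length-≤-suc remove    = ≤-refl
oneDel-length-≤-suc (there d) = s≤s (oneDel-length-≤-suc d)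

oneDel-≤* : ∀ {v u} → OneDel v u → length v ≤ length u → u ≤* v
oneDel-≤* (lower _) _           = n≤1+n _ ∷ Pointwise.refl ≤-refl
oneDel-≤* remove    lv≤lu       = ⊥-elim (1+n≰n lv≤lu)
oneDel-≤* (there d) (s≤s lv≤lu) = ≤-refl ∷ oneDel-≤* d lv≤lu

oneDel-bigs : ∀ {v u} → OneDel v u → suc (length u) ≤ length v → bigs u ≡ bigs v
oneDel-bigs (lower _) lu<lv = ⊥-elim (1+n≰n lu<lv)
oneDel-bigs remove    _     = refl
oneDel-bigs {a ∷ _} (there d) (s≤s lu<lv) with does (a ≟ 1)
... | true  = oneDel-bigs d lu<lv
... | false = cong (a ∷_) (oneDel-bigs d lu<lv)

lower-one : ∀ {f x} → IsComposition f → f ≤* x → sum f < sum x → ∃[ u ] OneDel x u × f ≤* u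
lower-one {g ∷ _} (1≤g ∷ cf) (g≤a ∷ f≤x) sf<sx with m≤n⇒m<n∨m≡n g≤a
... | inj₁ (s≤s g≤a′) = _ , lower (≤-trans 1≤g g≤a′) , g≤a′ ∷ f≤x
... | inj₂ refl with lower-one cf f≤x (+-cancelˡ-< g _ _ sf<sx)
...   | u , d , f≤u = _ , there d , ≤-refl ∷ f≤u

kDel-sum : ∀ {k x u} → KDel k x u → sum x ≡ sum u + k
kDel-sum zero-del = sym (+-identityʳ _)
kDel-sum {suc k} {u = u} (step-del x↝v v↝u) =
  trans (kDel-sum x↝v) (trans (cong (_+ k) (oneDel-sum v↝u)) (sym (+-suc (sum u) k)))

kDel-length-≤ : ∀ {k x u} → KDel k x u → length u ≤ length x
kDel-length-≤ zero-del           = ≤-refl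
kDel-length-≤ (step-del x↝v v↝u) = ≤-trans (oneDel-length-≤ v↝u) (kDel-length-≤ x↝v)

kDel-length-≤-+ : ∀ {k x u} → KDel k x u → length x ≤ k + length u
kDel-length-≤-+ zero-del = ≤-refl
kDel-length-≤-+ {suc k} {u = u} (step-del x↝v v↝u) =
  ≤-trans (kDel-length-≤-+ x↝v)
    (≤-trans (+-monoʳ-≤ k (oneDel-length-≤-suc v↝u)) (≤-reflexive (+-suc k (length u))))

kDel-≤* : ∀ {k x u} → KDel k x u → length x ≤ length u → u ≤* x
kDel-≤* zero-del _ = Pointwise.refl ≤-refl
kDel-≤* (step-del x↝v v↝u) lx≤lu =
  Pointwise.transitive ≤-trans
    (oneDel-≤* v↝u (≤-trans (kDel-length-≤ x↝v) lx≤lu))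
    (kDel-≤* x↝v (≤-trans lx≤lu (oneDel-length-≤ v↝u)))

kDel-bigs : ∀ {k x u} → KDel k x u → k + length u ≤ length x → bigs u ≡ bigs x
kDel-bigs zero-del _ = refl
kDel-bigs {suc k} {x} {u} (step-del {v = v} x↝v v↝u) k+lu≤lx =
  trans (oneDel-bigs v↝u lu<lv) (kDel-bigs x↝v k+lv≤lx)
  where
  open ≤-Reasoning
  lu<lv : suc (length u) ≤ length v
  lu<lv = +-cancelˡ-≤ k _ _ (begin
    k + suc (length u) ≡⟨ +-suc k (length u) ⟩
    suc k + length u   ≤⟨ k+lu≤lx ⟩
    length x           ≤⟨ kDel-length-≤-+ x↝v ⟩
    k + length v       ∎)
  k+lv≤lx : k + length v ≤ length x
  k+lv≤lx = begin
    k + length v       ≤⟨ +-monoʳ-≤ k (oneDel-length-≤-suc v↝u) ⟩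
    k + suc (length u) ≡⟨ +-suc k (length u) ⟩
    suc k + length u   ≤⟨ k+lu≤lx ⟩
    length x           ∎

kDel-there : ∀ {k a x u} → KDel k x u → KDel k (a ∷ x) (a ∷ u)
kDel-there zero-del           = zero-del
kDel-there (step-del x↝v v↝u) = step-del (kDel-there x↝v) (there v↝u)

oneDel-kDel : ∀ {k x v u} → OneDel x v → KDel k v u → KDel (suc k) x u
oneDel-kDel x↝v zero-del           = step-del zero-del x↝v
oneDel-kDel x↝v (step-del v↝t t↝u) = step-del (oneDel-kDel x↝v v↝t) t↝u

kDel-ones-bigs : ∀ x → KDel (ones x) x (bigs x)
kDel-ones-bigs []                = zero-del
kDel-ones-bigs (zero ∷ x)        = kDel-there (kDel-ones-bigs x)
kDel-ones-bigs (suc zero ∷ x)    = oneDel-kDel remove (kDel-ones-bigs x)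
kDel-ones-bigs (suc (suc a) ∷ x) = kDel-there (kDel-ones-bigs x)

lowering : ∀ {d f x} → IsComposition f → f ≤* x → sum f + d ≤ sum x → ∃[ u ] KDel d x u × f ≤* u
lowering {zero} _ f≤x _ = _ , zero-del , f≤x
lowering {suc d} {f} cf f≤x room with lower-one cf f≤x (<-≤-trans (m<m+n (sum f) (s≤s z≤n)) room)
... | v , x↝v , f≤v with lowering cf f≤v (≤-pred (subst₂ _≤_ (+-suc (sum f) d) (oneDel-sum x↝v) room))
...   | u , v↝u , f≤u = u , oneDel-kDel x↝v v↝u , f≤u

length-bigs+ones : ∀ x → length (bigs x) + ones x ≡ length x
length-bigs+ones []                = refl
length-bigs+ones (zero ∷ x)        = cong suc (length-bigs+ones x)
length-bigs+ones (suc zero ∷ x)    = trans (+-suc _ _) (cong suc (length-bigs+ones x))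
length-bigs+ones (suc (suc a) ∷ x) = cong suc (length-bigs+ones x)

length+length-bigs≤sum : ∀ {x} → IsComposition x → length x + length (bigs x) ≤ sum x
length+length-bigs≤sum [] = z≤n
length+length-bigs≤sum {suc zero ∷ _} (_ ∷ cx) = s≤s (length+length-bigs≤sum cx)
length+length-bigs≤sum {suc (suc a) ∷ x} (_ ∷ cx) = begin
  suc (length x) + suc (length (bigs x)) ≡⟨ cong suc (+-suc (length x) _) ⟩
  suc (suc (length x + length (bigs x))) ≤⟨ s≤s (s≤s (length+length-bigs≤sum cx)) ⟩
  suc (suc (sum x))                      ≤⟨ s≤s (s≤s (m≤n+m (sum x) a)) ⟩
  suc (suc a) + sum x                    ∎
  where open ≤-Reasoning

units-composition : ∀ x → IsComposition (units x)
units-composition []      = []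
units-composition (_ ∷ x) = ≤-refl ∷ units-composition x

sum-units : ∀ x → sum (units x) ≡ length x
sum-units []      = refl
sum-units (_ ∷ x) = cong suc (sum-units x)

units-≤* : ∀ {x} → IsComposition x → units x ≤* x
units-≤* []       = []
units-≤* (p ∷ cx) = p ∷ units-≤* cx

LargeIn : List ℕ → List ℕ → Set
LargeIn = Pointwise (λ a b → 2 ≤ a → 2 ≤ b)

LargeIn-from-floors : ∀ {x y} → IsComposition x →
  (∀ {f} → IsComposition f → sum f ≤ suc (length x) → f ≤* x → f ≤* y) → LargeIn x y
LargeIn-from-floors {[]} {[]} _ _ = []
LargeIn-from-floors {[]} {_ ∷ _} [] floor with floor [] z≤n []
... | ()
LargeIn-from-floors {_ ∷ x} {[]} (1≤a ∷ cx) floor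
  with floor (≤-refl ∷ units-composition x) (s≤s (≤-trans (≤-reflexive (sum-units x)) (n≤1+n _)))
             (1≤a ∷ units-≤* cx)
... | ()
LargeIn-from-floors {a ∷ x} {b ∷ y} (1≤a ∷ cx) floor = large-head ∷ LargeIn-from-floors cx floor-tail
  where
  large-head : 2 ≤ a → 2 ≤ b
  large-head 2≤a =
    head (floor (s≤s z≤n ∷ units-composition x) (s≤s (s≤s (≤-reflexive (sum-units x)))) (2≤a ∷ units-≤* cx))
  floor-tail : ∀ {f} → IsComposition f → sum f ≤ suc (length x) → f ≤* x → f ≤* y
  floor-tail cf sf f≤x = tail (floor (≤-refl ∷ cf) (s≤s sf) (1≤a ∷ f≤x))

≡-from-LargeIn-bigs : ∀ {x y} → IsComposition x → IsComposition y →
  LargeIn x y → LargeIn y x → bigs x ≡ bigs y → x ≡ y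
≡-from-LargeIn-bigs [] [] [] [] _ = refl
≡-from-LargeIn-bigs {suc zero ∷ _} {suc zero ∷ _} (_ ∷ cx) (_ ∷ cy) (_ ∷ xy) (_ ∷ yx) eq =
  cong (1 ∷_) (≡-from-LargeIn-bigs cx cy xy yx eq)
≡-from-LargeIn-bigs {suc zero ∷ _} {suc (suc _) ∷ _} _ _ _ (l ∷ _) _ = ⊥-elim (1+n≰n (l (s≤s (s≤s z≤n))))
≡-from-LargeIn-bigs {suc (suc _) ∷ _} {suc zero ∷ _} _ _ (l ∷ _) _ _ = ⊥-elim (1+n≰n (l (s≤s (s≤s z≤n))))
≡-from-LargeIn-bigs {suc (suc _) ∷ _} {suc (suc _) ∷ _} (_ ∷ cx) (_ ∷ cy) (_ ∷ xy) (_ ∷ yx) eq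
  with ∷-injective eq
... | refl , bigs≡ = cong (_ ∷_) (≡-from-LargeIn-bigs cx cy xy yx bigs≡)

floors-transfer : ∀ {k x y f} → (∀ {u} → KDel k x u → KDel k y u) → length y ≤ length x →
  IsComposition f → f ≤* x → sum f + k ≤ sum x → f ≤* y
floors-transfer {y = y} x⊆y ly≤lx cf f≤x room with lowering cf f≤x room
... | u , x↝u , f≤u = Pointwise.transitive ≤-trans f≤u (kDel-≤* (x⊆y x↝u) ly≤lu)
  where
  ly≤lu : length y ≤ length u
  ly≤lu = ≤-trans ly≤lx (≤-reflexive (trans (sym (Pointwise-length f≤x)) (Pointwise-length f≤u)))

LargeIn-from-deletions : ∀ {k x y} → IsComposition x → (∀ {u} → KDel k x u → KDel k y u) →
  length y ≤ length x → suc (length x) + k ≤ sum x → LargeIn x y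
LargeIn-from-deletions {k} cx x⊆y ly≤lx room = LargeIn-from-floors cx λ cf sf f≤x →
  floors-transfer x⊆y ly≤lx cf f≤x (≤-trans (+-monoˡ-≤ k sf) room)

suc-length+ones≤sum : ∀ {x} → IsComposition x → 3 * ones x + 1 ≤ sum x → suc (length x) + ones x ≤ sum x
suc-length+ones≤sum {x} cx 3k+1≤n =
  split (length-bigs+ones x) 3k+1≤n (length+length-bigs≤sum cx)
  where
  split : ∀ {b k m n} → b + k ≡ m → 3 * k + 1 ≤ n → m + b ≤ n → suc m + k ≤ n
  split {b} {k} {n = n} refl 3k+1≤n m+b≤n with b ≤? k
  ... | yes b≤k = begin
    suc (b + k) + k ≤⟨ +-monoˡ-≤ k (s≤s (+-monoˡ-≤ k b≤k)) ⟩
    suc (k + k) + k ≡⟨ triple k ⟩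
    3 * k + 1       ≤⟨ 3k+1≤n ⟩
    n               ∎
    where
    open ≤-Reasoning
    triple : ∀ k → suc (k + k) + k ≡ 3 * k + 1
    triple = solve-∀
  ... | no b≰k = begin
    suc (b + k) + k ≡⟨ +-suc (b + k) k ⟨
    b + k + suc k   ≤⟨ +-monoʳ-≤ (b + k) (≰⇒> b≰k) ⟩
    b + k + b       ≤⟨ m+b≤n ⟩
    n               ∎
    where open ≤-Reasoning

lemma4 : (k n : ℕ) → 3 * k + 1 ≤ n → (w : List ℕ) → IsCompositionOf n w → ones w ≡ k →
         (w′ : List ℕ) → IsComposition w′ → (∀ u → KDel k w u ⇔ KDel k w′ u) → w′ ≡ w
lemma4 k n 3k+1≤n w (cw , refl) refl w′ cw′ deletions≡ =
  sym (≡-from-LargeIn-bigs cw cw′ w⇒w′ w′⇒w bigs≡)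
  where
  w⊆w′ : ∀ {u} → KDel k w u → KDel k w′ u
  w⊆w′ = Equivalence.to (deletions≡ _)
  w′⊆w : ∀ {u} → KDel k w′ u → KDel k w u
  w′⊆w = Equivalence.from (deletions≡ _)
  w′↝bigs : KDel k w′ (bigs w)
  w′↝bigs = w⊆w′ (kDel-ones-bigs w)
  sum≡ : sum w′ ≡ sum w
  sum≡ = trans (kDel-sum w′↝bigs) (sym (kDel-sum (kDel-ones-bigs w)))
  length≤ : length w′ ≤ length w
  length≤ = ≤-trans (kDel-length-≤-+ w′↝bigs) (≤-reflexive (trans (+-comm k _) (length-bigs+ones w)))
  room-w : suc (length w) + k ≤ sum w
  room-w = suc-length+ones≤sum cw 3k+1≤n
  w⇒w′ : LargeIn w w′
  w⇒w′ = LargeIn-from-deletions cw w⊆w′ length≤ room-w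
  length≡ : length w ≡ length w′
  length≡ = Pointwise-length w⇒w′
  w′⇒w : LargeIn w′ w
  w′⇒w = LargeIn-from-deletions cw′ w′⊆w (≤-reflexive length≡)
           (subst₂ (λ m s → suc m + k ≤ s) length≡ (sym sum≡) room-w)
  bigs≡ : bigs w ≡ bigs w′
  bigs≡ = trans (sym (filter-idem _ w))
            (kDel-bigs w′↝bigs (≤-reflexive (trans (+-comm k _) (trans (length-bigs+ones w) length≡))))
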